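{- Let $p$ and $q$ be primes with $p\mid q-1$, let $r\in\mathbb Z$ satisfy $r^p\equiv 1\pmod q$ and $r\not\equiv1\pmod q$, let $G=\langle \alpha,\tau:\ \alpha^q=1,\ \tau^p=1,\ \alpha\tau=\tau\alpha^r\rangle$, and let $G'=[G,G]$ (which equals $\langle\alpha\rangle$). Let $S$ be a sequence over $G$ with $\pi(S)\subseteq G'$ and $|S|\geq q$. Then $1\in\Pi(S)$, i.e., $S$ has a nonempty product-one subsequence.
   Context: A sequence over a group $G$ is a finite unordered list of elements of $G$ with repetition allowed; its length $|S|$ is its number of terms with multiplicity; a subsequence is a sub-multiset. For a sequence $S$, $\pi(S)\subseteq G$ denotes the set of all products of the terms of $S$ over all orderings of its terms, and $\Pi(S)$ is the union of $\pi(T)$ over all nonempty subsequences $T$ of $S$. A sequence is product-one if $1\in\pi(S)$. -}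

module Defs where

open import Data.Nat using (ℕ; zero; suc; _+_; _*_; _^_; _%_; NonZero)
open import Data.Nat.DivMod using (m%n<n)
open import Data.Fin using (Fin; toℕ; fromℕ<)
open import Data.Product using (_×_; _,_; ∃; Σ)
open import Data.List using (List; []; _∷_; foldr)
open import Data.List.Relation.Binary.Permutation.Propositional using (_↭_)
open import Data.List.Relation.Binary.Sublist.Propositional using (_⊆_)
open import Data.Integer using (ℤ)
open import Data.Integer.DivMod using (_%ℕ_)
open import Relation.Binary.PropositionalEquality using (_≡_)

modF : (n : ℕ) .{{_ : NonZero n}} → ℕ → Fin n
modF n m = fromℕ< (m%n<n m n)

-- The metacyclic group G = ⟨α, τ | α^q = 1, τ^p = 1, ατ = τα^r⟩,
-- realised concretely: the pair (a , b) stands for the normal form τ^b α^a.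
-- Since α^a τ^d = τ^d α^(a r^d), we get
--   (τ^b α^a)(τ^d α^c) = τ^(b+d) α^(a r^d + c).
-- (This is well defined because r^p ≡ 1 mod q.)
module Metacyclic (q p : ℕ) .{{_ : NonZero q}} .{{_ : NonZero p}} (r : ℤ) where

  G : Set
  G = Fin q × Fin p

  r̄ : ℕ
  r̄ = r %ℕ q

  e : G
  e = modF q 0 , modF p 0

  α : G
  α = modF q 1 , modF p 0

  τ : G
  τ = modF q 0 , modF p 1

  infixl 7 _∙_
  _∙_ : G → G → G
  (a , b) ∙ (c , d) =
    modF q (toℕ a * r̄ ^ toℕ d + toℕ c) , modF p (toℕ b + toℕ d)

  prod : List G → G
  prod = foldr _∙_ e

  data InDerived : G → Set where
    d-one  : InDerived e
    d-comm : ∀ x y x' y' → x ∙ x' ≡ e → y ∙ y' ≡ e →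
             InDerived (x' ∙ y' ∙ x ∙ y)
    d-mul  : ∀ {g h} → InDerived g → InDerived h → InDerived (g ∙ h)
    d-inv  : ∀ {g g'} → InDerived g → g ∙ g' ≡ e → InDerived g'

  _∈π_ : G → List G → Set
  g ∈π S = Σ (List G) λ L → (L ↭ S) × (prod L ≡ g)

  _∈Π_ : G → List G → Set
  g ∈Π S = Σ (List G) λ T → (T ⊆ S) × (Σ G λ t → Σ (List G) λ T' → T ≡ t ∷ T') × (g ∈π T)

{-# OPTIONS --safe #-}
module Submission where

-- Write g = τ^b α^a; then π(S) ⊆ G' means that the τ-exponents of S sum to 0 mod p.  Such an S
-- splits, up to reordering, into blocks T with τ-exponent sum 0 mod p whose proper prefixes have
-- pairwise distinct τ-exponent sums.  The rotation V U of a block T = U V has product α^(r^k c),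
-- where α^c is the product of T and k the τ-exponent sum of U; as r has order p modulo q, the |T|
-- rotations give |T| distinct values r^k c, all nonzero unless T is already product-one.  So each
-- block contributes a set of |T| + 1 exponents containing 0, and by the Cauchy–Davenport theorem
-- in ℤ/q the set of c such that α^c is the product of a reordered subsequence grows by |T| per
-- block.  Once |S| ≥ q it cannot keep growing, and 0 is attained by a nonempty subsequence.

module ModularArithmetic where

  open import Data.Nat
  open import Data.Nat.Properties
  open import Data.Nat.DivMod
  open import Data.Nat.Divisibility using (_∣_; divides; m%n≡0⇒n∣m)
  open import Data.Nat.Primality using (Prime; prime⇒nonTrivial)
  open import Data.Nat.Coprimality using (prime⇒coprime; coprime-Bézout)
  open import Data.Nat.GCD using (module Bézout)
  open import Data.Nat.Tactic.RingSolver using (solve-∀; solve)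
  open import Data.List using ([]; _∷_)
  open import Data.Product using (∃; _,_)
  open import Data.Sum using (inj₁; inj₂)
  open import Level using (0ℓ)
  open import Relation.Nullary using (¬_; Dec; contradiction)
  open import Relation.Binary using (Setoid)
  import Relation.Binary.Construct.On as On
  import Relation.Binary.Reasoning.Setoid as SetoidReasoning
  open import Relation.Binary.PropositionalEquality

  module Congruence (n : ℕ) .{{_ : NonZero n}} where

    infix 4 _≈_
    _≈_ : ℕ → ℕ → Set
    a ≈ b = a % n ≡ b % n

    ≈-setoid : Setoid 0ℓ 0ℓ
    ≈-setoid = On.setoid (setoid ℕ) (_% n)

    open Setoid ≈-setoid public
      using () renaming (refl to ≈-refl; sym to ≈-sym; trans to ≈-trans; reflexive to ≈-reflexive)
    module ≈-Reasoning = SetoidReasoning ≈-setoid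

    _≈?_ : ∀ a b → Dec (a ≈ b)
    a ≈? b = a % n ≟ b % n

    %-≈ : ∀ a → a % n ≈ a
    %-≈ a = m%n%n≡m%n a n

    +-cong : ∀ {a b c d} → a ≈ b → c ≈ d → a + c ≈ b + d
    +-cong {a} {b} {c} {d} a≈b c≈d = begin
      (a + c) % n          ≡⟨ %-distribˡ-+ a c n ⟩
      (a % n + c % n) % n  ≡⟨ cong₂ (λ x y → (x + y) % n) a≈b c≈d ⟩
      (b % n + d % n) % n  ≡⟨ %-distribˡ-+ b d n ⟨
      (b + d) % n          ∎
      where open ≡-Reasoning

    *-cong : ∀ {a b c d} → a ≈ b → c ≈ d → a * c ≈ b * d
    *-cong {a} {b} {c} {d} a≈b c≈d = begin
      (a * c) % n            ≡⟨ %-distribˡ-* a c n ⟩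
      (a % n * (c % n)) % n  ≡⟨ cong₂ (λ x y → (x * y) % n) a≈b c≈d ⟩
      (b % n * (d % n)) % n  ≡⟨ %-distribˡ-* b d n ⟨
      (b * d) % n            ∎
      where open ≡-Reasoning

    ^-congˡ : ∀ {a b} k → a ≈ b → a ^ k ≈ b ^ k
    ^-congˡ zero    a≈b = refl
    ^-congˡ (suc k) a≈b = *-cong a≈b (^-congˡ k a≈b)

    x^m≈1⇒x^[k*m]≈1 : ∀ {x m} k → x ^ m ≈ 1 → x ^ (k * m) ≈ 1
    x^m≈1⇒x^[k*m]≈1 {x} {m} k x^m≈1 = begin
      x ^ (k * m)   ≡⟨ cong (x ^_) (*-comm k m) ⟩
      x ^ (m * k)   ≡⟨ ^-*-assoc x m k ⟨
      (x ^ m) ^ k   ≈⟨ ^-congˡ k x^m≈1 ⟩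
      1 ^ k         ≡⟨ ^-zeroˡ k ⟩
      1             ∎
      where open ≈-Reasoning

    0%n≡0 : 0 % n ≡ 0
    0%n≡0 = m<n⇒m%n≡m (>-nonZero⁻¹ n)

    0≈n : 0 ≈ n
    0≈n = trans 0%n≡0 (sym (n%n≡0 n))

    *n≈0 : ∀ k → k * n ≈ 0
    *n≈0 k = trans (m*n%n≡0 k n) (sym 0%n≡0)

    ∣⇒≈0 : ∀ {a} → n ∣ a → a ≈ 0
    ∣⇒≈0 (divides k refl) = *n≈0 k

    ≈0⇒∣ : ∀ {a} → a ≈ 0 → n ∣ a
    ≈0⇒∣ {a} a≈0 = m%n≡0⇒n∣m a n (trans a≈0 0%n≡0)

    ≈⇒≡ : ∀ {a b} → a < n → b < n → a ≈ b → a ≡ b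
    ≈⇒≡ a<n b<n a≈b = trans (sym (m<n⇒m%n≡m a<n)) (trans a≈b (m<n⇒m%n≡m b<n))

    neg : ℕ → ℕ
    neg a = n ∸ a % n

    +-inverseʳ : ∀ a → a + neg a ≈ 0
    +-inverseʳ a = begin
      a + neg a        ≈⟨ +-cong (%-≈ a) ≈-refl ⟨
      a % n + neg a    ≡⟨ m+[n∸m]≡n (m%n≤n a n) ⟩
      n                ≈⟨ 0≈n ⟨
      0                ∎
      where open ≈-Reasoning

    +-inverseˡ : ∀ a → neg a + a ≈ 0
    +-inverseˡ a = ≈-trans (≈-reflexive (+-comm (neg a) a)) (+-inverseʳ a)

    +-cancelˡ : ∀ a {b c} → a + b ≈ a + c → b ≈ c
    +-cancelˡ a {b} {c} eq = begin
      b                ≈⟨ +-cong (+-inverseˡ a) ≈-refl ⟨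
      neg a + a + b    ≡⟨ +-assoc (neg a) a b ⟩
      neg a + (a + b)  ≈⟨ +-cong (≈-refl {neg a}) eq ⟩
      neg a + (a + c)  ≡⟨ +-assoc (neg a) a c ⟨
      neg a + a + c    ≈⟨ +-cong (+-inverseˡ a) ≈-refl ⟩
      c                ∎
      where open ≈-Reasoning

    +-cancelʳ : ∀ a {b c} → b + a ≈ c + a → b ≈ c
    +-cancelʳ a {b} {c} eq =
      +-cancelˡ a (≈-trans (≈-reflexive (+-comm a b)) (≈-trans eq (≈-reflexive (+-comm c a))))

  module PrimeModulus (q : ℕ) .{{_ : NonZero q}} (q-prime : Prime q) where
    open Congruence q

    inverse : ∀ c → ¬ c ≈ 0 → ∃ λ c' → c * c' ≈ 1
    inverse c c≉0 = fromBézout (coprime-Bézout (prime⇒coprime q-prime (m%n<n c q)))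
      where
      c̄ = c % q
      instance
        c̄-nonZero : NonZero c̄
        c̄-nonZero = ≢-nonZero λ c̄≡0 → c≉0 (trans c̄≡0 (sym 0%n≡0))
      fromBézout : Bézout.Identity 1 q c̄ → ∃ λ c' → c * c' ≈ 1
      fromBézout (Bézout.-+ x y eq) = y , (begin
        c * y       ≈⟨ *-cong (%-≈ c) ≈-refl ⟨
        c̄ * y       ≡⟨ *-comm c̄ y ⟩
        y * c̄       ≡⟨ eq ⟨
        1 + x * q   ≈⟨ +-cong ≈-refl (*n≈0 x) ⟩
        1 + 0       ∎)
        where open ≈-Reasoning
      -- Here c y ≡ -1, so y (q - 1) inverts c.
      fromBézout (Bézout.+- x y eq) = y * (q ∸ 1) , +-cancelʳ (q ∸ 1) (begin
        c * (y * (q ∸ 1)) + (q ∸ 1)  ≈⟨ +-cong (*-cong (%-≈ c) ≈-refl) ≈-refl ⟨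
        c̄ * (y * (q ∸ 1)) + (q ∸ 1)  ≡⟨ factor c̄ y (q ∸ 1) ⟩
        (1 + y * c̄) * (q ∸ 1)        ≡⟨ cong (_* (q ∸ 1)) eq ⟩
        x * q * (q ∸ 1)               ≈⟨ *-cong (*n≈0 x) ≈-refl ⟩
        0                             ≈⟨ 0≈n ⟩
        q                             ≡⟨ m+[n∸m]≡n (>-nonZero⁻¹ q) ⟨
        1 + (q ∸ 1)                   ∎)
        where
        open ≈-Reasoning
        factor : ∀ a b m → a * (b * m) + m ≡ (1 + b * a) * m
        factor = solve-∀

    *-cancelˡ : ∀ c {a b} → ¬ c ≈ 0 → c * a ≈ c * b → a ≈ b
    *-cancelˡ c {a} {b} c≉0 eq with inverse c c≉0
    ... | c' , cc'≈1 = begin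
      a             ≡⟨ *-identityˡ a ⟨
      1 * a         ≈⟨ *-cong cc'≈1 ≈-refl ⟨
      c * c' * a    ≡⟨ solve (c ∷ c' ∷ a ∷ []) ⟩
      c' * (c * a)  ≈⟨ *-cong (≈-refl {c'}) eq ⟩
      c' * (c * b)  ≡⟨ solve (c ∷ c' ∷ b ∷ []) ⟩
      c * c' * b    ≈⟨ *-cong cc'≈1 ≈-refl ⟩
      1 * b         ≡⟨ *-identityˡ b ⟩
      b             ∎
      where open ≈-Reasoning

    *-nonZero : ∀ {a b} → ¬ a ≈ 0 → ¬ b ≈ 0 → ¬ a * b ≈ 0
    *-nonZero {a} {b} a≉0 b≉0 ab≈0 =
      b≉0 (*-cancelˡ a a≉0 (≈-trans ab≈0 (≈-reflexive (sym (*-zeroʳ a)))))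

  module Period (n p : ℕ) .{{_ : NonZero n}} .{{_ : NonZero p}} (x : ℕ) (x^p≈1 : Congruence._≈_ n (x ^ p) 1) where
    open Congruence n
    private module P = Congruence p

    x^m≈x^[m%p] : ∀ m → x ^ m ≈ x ^ (m % p)
    x^m≈x^[m%p] m = begin
      x ^ m                            ≡⟨ cong (x ^_) (m≡m%n+[m/n]*n m p) ⟩
      x ^ (m % p + m / p * p)          ≡⟨ ^-distribˡ-+-* x (m % p) (m / p * p) ⟩
      x ^ (m % p) * x ^ (m / p * p)    ≈⟨ *-cong (≈-refl {x ^ (m % p)}) (x^m≈1⇒x^[k*m]≈1 (m / p) x^p≈1) ⟩
      x ^ (m % p) * 1                  ≡⟨ *-identityʳ (x ^ (m % p)) ⟩
      x ^ (m % p)                      ∎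
      where open ≈-Reasoning

    ^-congʳ : ∀ {a b} → a P.≈ b → x ^ a ≈ x ^ b
    ^-congʳ {a} {b} a≈b = begin
      x ^ a         ≈⟨ x^m≈x^[m%p] a ⟩
      x ^ (a % p)   ≡⟨ cong (x ^_) a≈b ⟩
      x ^ (b % p)   ≈⟨ x^m≈x^[m%p] b ⟨
      x ^ b         ∎
      where open ≈-Reasoning

  module PrimeOrder (q p : ℕ) .{{_ : NonZero q}} .{{_ : NonZero p}} (q-prime : Prime q) (p-prime : Prime p)
                    (x : ℕ) (x^p≈1 : Congruence._≈_ q (x ^ p) 1) (x≉1 : ¬ Congruence._≈_ q x 1) where
    open Congruence q
    open PrimeModulus q q-prime
    open Period q p x x^p≈1
    private module P = Congruence p

    1≉0 : ¬ 1 ≈ 0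
    1≉0 1≈0 = 1+n≢0 (trans (sym (m<n⇒m%n≡m 1<q)) (trans 1≈0 0%n≡0))
      where
      1<q : 1 < q
      1<q = nonTrivial⇒n>1 q {{prime⇒nonTrivial q-prime}}

    x^≉0 : ∀ k → ¬ x ^ k ≈ 0
    x^≉0 zero    = 1≉0
    x^≉0 (suc k) = *-nonZero x≉0 (x^≉0 k)
      where
      0^m≡0 : ∀ m → .{{NonZero m}} → 0 ^ m ≡ 0
      0^m≡0 (suc m) = refl
      x≉0 : ¬ x ≈ 0
      x≉0 x≈0 = 1≉0 (≈-trans (≈-sym x^p≈1) (≈-trans (^-congˡ p x≈0) (≈-reflexive (0^m≡0 p))))

    ≈1-from-exponents : ∀ {m₁ m₂} a b → x ^ m₁ ≈ 1 → x ^ m₂ ≈ 1 → 1 + a * m₁ ≡ b * m₂ → x ≈ 1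
    ≈1-from-exponents {m₁} {m₂} a b x^m₁≈1 x^m₂≈1 eq = begin
      x                      ≡⟨ *-identityʳ x ⟨
      x * 1                  ≈⟨ *-cong (≈-refl {x}) (x^m≈1⇒x^[k*m]≈1 a x^m₁≈1) ⟨
      x * x ^ (a * m₁)       ≡⟨ cong (x ^_) eq ⟩
      x ^ (b * m₂)           ≈⟨ x^m≈1⇒x^[k*m]≈1 b x^m₂≈1 ⟩
      1                      ∎
      where open ≈-Reasoning

    x^d≈1⇒d≈0 : ∀ d → x ^ d ≈ 1 → d P.≈ 0
    x^d≈1⇒d≈0 d x^d≈1 with d % p in d%p
    ... | zero  = sym P.0%n≡0
    ... | suc k = contradiction (fromBézout (coprime-Bézout (prime⇒coprime p-prime (subst (_< p) d%p (m%n<n d p))))) x≉1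
      where
      x^d%p≈1 : x ^ suc k ≈ 1
      x^d%p≈1 = ≈-trans (≈-reflexive (cong (x ^_) (sym d%p))) (≈-trans (≈-sym (x^m≈x^[m%p] d)) x^d≈1)
      fromBézout : Bézout.Identity 1 p (suc k) → x ≈ 1
      fromBézout (Bézout.+- a b eq) = ≈1-from-exponents b a x^d%p≈1 x^p≈1 eq
      fromBézout (Bézout.-+ a b eq) = ≈1-from-exponents a b x^p≈1 x^d%p≈1 eq

    x^[b∸a]≈1 : ∀ {a b} → a ≤ b → x ^ a ≈ x ^ b → x ^ (b ∸ a) ≈ 1
    x^[b∸a]≈1 {a} {b} a≤b x^a≈x^b = *-cancelˡ (x ^ a) (x^≉0 a) (begin
      x ^ a * x ^ (b ∸ a)   ≡⟨ ^-distribˡ-+-* x a (b ∸ a) ⟨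
      x ^ (a + (b ∸ a))     ≡⟨ cong (x ^_) (m+[n∸m]≡n a≤b) ⟩
      x ^ b                 ≈⟨ x^a≈x^b ⟨
      x ^ a                 ≡⟨ *-identityʳ (x ^ a) ⟨
      x ^ a * 1             ∎)
      where open ≈-Reasoning

    ^-injective-≤ : ∀ {a b} → a ≤ b → x ^ a ≈ x ^ b → a P.≈ b
    ^-injective-≤ {a} {b} a≤b x^a≈x^b = begin
      a               ≡⟨ +-identityʳ a ⟨
      a + 0           ≈⟨ P.+-cong (P.≈-refl {a}) (x^d≈1⇒d≈0 (b ∸ a) (x^[b∸a]≈1 a≤b x^a≈x^b)) ⟨
      a + (b ∸ a)     ≡⟨ m+[n∸m]≡n a≤b ⟩
      b               ∎
      where open P.≈-Reasoning

    ^-injective : ∀ a b → x ^ a ≈ x ^ b → a P.≈ b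
    ^-injective a b x^a≈x^b with ≤-total a b
    ... | inj₁ a≤b = ^-injective-≤ a≤b x^a≈x^b
    ... | inj₂ b≤a = sym (^-injective-≤ b≤a (≈-sym x^a≈x^b))

open ModularArithmetic

module IntegerCongruences where

  open import Data.Nat as ℕ using (ℕ; zero; suc; NonZero)
  open import Data.Integer as ℤ using (ℤ; +_; _-_; _%ℕ_; _/ℕ_)
  import Data.Integer.Properties as ℤₚ
  open import Data.Integer.DivMod using (a≡a%ℕn+[a/ℕn]*n)
  import Data.Integer.Divisibility as ℤD
  open import Data.Integer.Divisibility.Signed
    using (_∣_; divides; ∣ᵤ⇒∣; ∣⇒∣ᵤ; ∣m∣n⇒∣m+n; ∣m∣n⇒∣m-n; ∣n⇒∣m*n; ∣m⇒∣m*n)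
  open import Data.Integer.Tactic.RingSolver using (solve-∀)
  open import Relation.Nullary using (¬_)
  open import Relation.Binary.PropositionalEquality

  module IntegerResidue (q : ℕ) .{{_ : NonZero q}} where
    open Congruence q

    ∣[N-1]⇒N≈1 : ∀ N → (+ q) ∣ (+ N - + 1) → N ≈ 1
    ∣[N-1]⇒N≈1 zero    q∣-1 = ≈-sym (∣⇒≈0 (∣⇒∣ᵤ q∣-1))
    ∣[N-1]⇒N≈1 (suc M) q∣M  = +-cong (≈-refl {1}) (∣⇒≈0 (∣⇒∣ᵤ q∣M))

    N≈1⇒∣[N-1] : ∀ N → N ≈ 1 → (+ q) ∣ (+ N - + 1)
    N≈1⇒∣[N-1] zero    0≈1   = ∣ᵤ⇒∣ (≈0⇒∣ (≈-sym 0≈1))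
    N≈1⇒∣[N-1] (suc M) 1+M≈1 = ∣ᵤ⇒∣ (≈0⇒∣ (+-cancelˡ 1 {M} {0} 1+M≈1))

    ∣x-y⇒∣x^k-y^k : ∀ {x y} k → (+ q) ∣ (x - y) → (+ q) ∣ (x ℤ.^ k - y ℤ.^ k)
    ∣x-y⇒∣x^k-y^k         zero    _     = divides (+ 0) refl
    ∣x-y⇒∣x^k-y^k {x} {y} (suc k) q∣x-y = subst ((+ q) ∣_) (sym (split x y (x ℤ.^ k) (y ℤ.^ k)))
      (∣m∣n⇒∣m+n (∣n⇒∣m*n x (∣x-y⇒∣x^k-y^k k q∣x-y)) (∣m⇒∣m*n (y ℤ.^ k) q∣x-y))
      where
      split : ∀ x y a b → x ℤ.* a - y ℤ.* b ≡ x ℤ.* (a - b) ℤ.+ (x - y) ℤ.* b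
      split = solve-∀

    pos-^ : ∀ a k → (+ a) ℤ.^ k ≡ + (a ℕ.^ k)
    pos-^ a zero    = refl
    pos-^ a (suc k) = trans (cong ((+ a) ℤ.*_) (pos-^ a k)) (sym (ℤₚ.pos-* a (a ℕ.^ k)))

    module _ (r : ℤ) where

      r̄ : ℕ
      r̄ = r %ℕ q

      ∣r-r̄ : (+ q) ∣ (r - + r̄)
      ∣r-r̄ = divides (r /ℕ q) (trans (cong (_- + r̄) (a≡a%ℕn+[a/ℕn]*n r q)) (cancel (+ r̄) (r /ℕ q ℤ.* + q)))
        where
        cancel : ∀ a b → a ℤ.+ b - a ≡ b
        cancel = solve-∀

      r^k≡1⇒r̄^k≈1 : ∀ k → (+ q) ℤD.∣ (r ℤ.^ k - + 1) → r̄ ℕ.^ k ≈ 1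
      r^k≡1⇒r̄^k≈1 k q∣r^k-1 = ∣[N-1]⇒N≈1 (r̄ ℕ.^ k)
        (subst ((+ q) ∣_) (trans (cancel (r ℤ.^ k) ((+ r̄) ℤ.^ k)) (cong (_- + 1) (pos-^ r̄ k)))
          (∣m∣n⇒∣m-n {m = r ℤ.^ k - + 1} (∣ᵤ⇒∣ q∣r^k-1) (∣x-y⇒∣x^k-y^k {r} {+ r̄} k ∣r-r̄)))
        where
        cancel : ∀ a b → (a - + 1) - (a - b) ≡ b - + 1
        cancel = solve-∀

      r≢1⇒r̄≉1 : ¬ (+ q) ℤD.∣ (r - + 1) → ¬ r̄ ≈ 1
      r≢1⇒r̄≉1 q∤r-1 r̄≈1 = q∤r-1 (∣⇒∣ᵤ (subst ((+ q) ∣_) (telescope r (+ r̄))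
        (∣m∣n⇒∣m+n ∣r-r̄ (N≈1⇒∣[N-1] r̄ r̄≈1))))
        where
        telescope : ∀ a b → (a - b) ℤ.+ (b - + 1) ≡ a - + 1
        telescope = solve-∀

open IntegerCongruences

module FiniteSubsets where

  open import Data.Nat
  open import Data.Nat.Properties
  open import Data.Bool using (Bool; true; false; _∧_; _∨_)
  open import Data.Fin using (Fin; zero; suc)
  import Data.Fin.Properties as Finₚ
  open import Data.Fin.Permutation using (permutation)
  open import Data.Product using (∃; _,_)
  open import Function using (_∘_)
  open import Data.Empty using (⊥-elim)
  open import Data.List using (List; []; _∷_; length)
  open import Data.List.Membership.Propositional using (_∈_)
  open import Data.List.Relation.Unary.Any using (here; there)
  open import Data.List.Relation.Unary.All using (All; []; _∷_)
  open import Data.List.Relation.Unary.AllPairs using ([]; _∷_)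
  open import Data.List.Relation.Unary.Unique.Propositional using (Unique)
  open import Relation.Nullary using (does; yes; no)
  open import Algebra.Properties.CommutativeMonoid.Sum +-0-commutativeMonoid
    using (sum; sum-permute; ∑-distrib-+; sum-cong-≗)
  open import Relation.Binary.PropositionalEquality

  private variable n : ℕ

  FSet : ℕ → Set
  FSet n = Fin n → Bool

  infixr 6 _∪_
  infixr 7 _∩_
  infix 4 _⊆_

  _∪_ : FSet n → FSet n → FSet n
  (A ∪ B) x = A x ∨ B x

  _∩_ : FSet n → FSet n → FSet n
  (A ∩ B) x = A x ∧ B x

  _⊆_ : FSet n → FSet n → Set
  A ⊆ B = ∀ x → A x ≡ true → B x ≡ true

  indicator : Bool → ℕ
  indicator true  = 1
  indicator false = 0

  card : FSet n → ℕ
  card A = sum (indicator ∘ A)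

  card-∪-∩ : (A B : FSet n) → card (A ∪ B) + card (A ∩ B) ≡ card A + card B
  card-∪-∩ A B = begin
    card (A ∪ B) + card (A ∩ B)
      ≡⟨ ∑-distrib-+ (indicator ∘ (A ∪ B)) (indicator ∘ (A ∩ B)) ⟨
    sum (λ x → indicator ((A ∪ B) x) + indicator ((A ∩ B) x))
      ≡⟨ sum-cong-≗ (λ x → pointwise (A x) (B x)) ⟩
    sum (λ x → indicator (A x) + indicator (B x))
      ≡⟨ ∑-distrib-+ (indicator ∘ A) (indicator ∘ B) ⟩
    card A + card B
      ∎
    where
    open ≡-Reasoning
    pointwise : ∀ a b → indicator (a ∨ b) + indicator (a ∧ b) ≡ indicator a + indicator b
    pointwise true  true  = refl
    pointwise true  false = refl
    pointwise false true  = refl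
    pointwise false false = refl

  card-cong : {A B : FSet n} → (∀ x → A x ≡ B x) → card A ≡ card B
  card-cong A≗B = sum-cong-≗ (cong indicator ∘ A≗B)

  card-permute : (A : FSet n) (f g : Fin n → Fin n) →
                 (∀ y → f (g y) ≡ y) → (∀ x → g (f x) ≡ x) → card (A ∘ f) ≡ card A
  card-permute A f g f∘g g∘f = sym (sum-permute (indicator ∘ A) (permutation f g f∘g g∘f))

  card≤n : (A : FSet n) → card A ≤ n
  card≤n {zero}  A = z≤n
  card≤n {suc n} A = +-mono-≤ (indicator≤1 (A zero)) (card≤n (A ∘ suc))
    where
    indicator≤1 : ∀ a → indicator a ≤ 1
    indicator≤1 true  = ≤-refl
    indicator≤1 false = z≤n

  card-full : (A : FSet n) → (∀ x → A x ≡ true) → card A ≡ n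
  card-full {zero}  A full = refl
  card-full {suc n} A full rewrite full zero = cong suc (card-full (A ∘ suc) (full ∘ suc))

  card-empty : (A : FSet n) → (∀ x → A x ≡ false) → card A ≡ 0
  card-empty {zero}  A empty = refl
  card-empty {suc n} A empty rewrite empty zero = card-empty (A ∘ suc) (empty ∘ suc)

  indicator-mono : ∀ a b → (a ≡ true → b ≡ true) → indicator a ≤ indicator b
  indicator-mono true  b a⇒b rewrite a⇒b refl = ≤-refl
  indicator-mono false b a⇒b = z≤n

  card-mono : (A B : FSet n) → A ⊆ B → card A ≤ card B
  card-mono {zero}  A B A⊆B = z≤n
  card-mono {suc n} A B A⊆B =
    +-mono-≤ (indicator-mono (A zero) (B zero) (A⊆B zero)) (card-mono (A ∘ suc) (B ∘ suc) (A⊆B ∘ suc))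

  card-mono-< : (A B : FSet n) → A ⊆ B → ∀ y → B y ≡ true → A y ≡ false → card A < card B
  card-mono-< {suc n} A B A⊆B zero    By Ay rewrite By | Ay = s≤s (card-mono (A ∘ suc) (B ∘ suc) (A⊆B ∘ suc))
  card-mono-< {suc n} A B A⊆B (suc y) By Ay =
    +-mono-≤-< (indicator-mono (A zero) (B zero) (A⊆B zero)) (card-mono-< (A ∘ suc) (B ∘ suc) (A⊆B ∘ suc) y By Ay)

  card-pos⇒∃ : (A : FSet n) → 1 ≤ card A → ∃ λ x → A x ≡ true
  card-pos⇒∃ {suc n} A 1≤∣A∣ with A zero in A0
  ... | true  = zero , A0
  ... | false with card-pos⇒∃ (A ∘ suc) 1≤∣A∣
  ...   | x , Ax = suc x , Ax

  ∈⇒card-pos : (A : FSet n) → ∀ x → A x ≡ true → 1 ≤ card A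
  ∈⇒card-pos {suc n} A zero    Ax rewrite Ax = s≤s z≤n
  ∈⇒card-pos {suc n} A (suc x) Ax = ≤-trans (∈⇒card-pos (A ∘ suc) x Ax) (m≤n+m _ (indicator (A zero)))

  subsingleton⇒card≤1 : (A : FSet n) → (∀ x y → A x ≡ true → A y ≡ true → x ≡ y) → card A ≤ 1
  subsingleton⇒card≤1 {zero}  A unique = z≤n
  subsingleton⇒card≤1 {suc n} A unique with A zero in A0
  ... | true  = ≤-reflexive (cong suc (card-empty (A ∘ suc) rest-empty))
    where
    rest-empty : ∀ x → A (suc x) ≡ false
    rest-empty x with A (suc x) in Ax
    ... | false = refl
    ... | true  with () ← unique zero (suc x) A0 Ax
  ... | false = subsingleton⇒card≤1 (A ∘ suc) λ x y Ax Ay → Finₚ.suc-injective (unique (suc x) (suc y) Ax Ay)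

  card-∩-pos : (A B : FSet n) → n < card A + card B → 1 ≤ card (A ∩ B)
  card-∩-pos {n} A B n<∣A∣+∣B∣ = +-cancelˡ-≤ n 1 (card (A ∩ B)) (begin
    n + 1                        ≡⟨ +-comm n 1 ⟩
    suc n                        ≤⟨ n<∣A∣+∣B∣ ⟩
    card A + card B              ≡⟨ card-∪-∩ A B ⟨
    card (A ∪ B) + card (A ∩ B)  ≤⟨ +-monoˡ-≤ (card (A ∩ B)) (card≤n (A ∪ B)) ⟩
    n + card (A ∩ B)             ∎)
    where open ≤-Reasoning

  module _ {n : ℕ} where

    ⁅_⁆ : Fin n → FSet n
    ⁅ x ⁆ y = does (x Finₚ.≟ y)

    ⁅⁆-elim : ∀ {x y} → ⁅ x ⁆ y ≡ true → x ≡ y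
    ⁅⁆-elim {x} {y} with x Finₚ.≟ y
    ... | yes x≡y = λ _ → x≡y

    card-⁅⁆ : ∀ x → card ⁅ x ⁆ ≡ 1
    card-⁅⁆ x = ≤-antisym
      (subsingleton⇒card≤1 ⁅ x ⁆ λ y y' xy xy' → trans (sym (⁅⁆-elim {x} xy)) (⁅⁆-elim {x} xy'))
      (∈⇒card-pos ⁅ x ⁆ x (x∈⁅x⁆ x))
      where
      x∈⁅x⁆ : ∀ x → ⁅ x ⁆ x ≡ true
      x∈⁅x⁆ x with x Finₚ.≟ x
      ... | yes _  = refl
      ... | no x≢x = ⊥-elim (x≢x refl)

    members : List (Fin n) → FSet n
    members []       = λ _ → false
    members (x ∷ xs) = ⁅ x ⁆ ∪ members xs

    members-elim : ∀ xs {y} → members xs y ≡ true → y ∈ xs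
    members-elim (x ∷ xs) {y} y∈ with x Finₚ.≟ y
    ... | yes refl = here refl
    ... | no  _    = there (members-elim xs y∈)

    members-∉ : ∀ {x} xs → All (x ≢_) xs → members xs x ≡ false
    members-∉ []       []            = refl
    members-∉ {x} (y ∷ xs) (x≢y ∷ x∉xs) with y Finₚ.≟ x
    ... | yes y≡x = ⊥-elim (x≢y (sym y≡x))
    ... | no  _   = members-∉ xs x∉xs

    card-members : ∀ xs → Unique xs → card (members xs) ≡ length xs
    card-members []       []              = card-empty (members []) (λ _ → refl)
    card-members (x ∷ xs) (x∉xs ∷ unique) = begin
      card (members (x ∷ xs))                               ≡⟨ +-identityʳ _ ⟨
      card (members (x ∷ xs)) + 0                           ≡⟨ cong (card (members (x ∷ xs)) +_) (card-empty _ disjoint) ⟨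
      card (⁅ x ⁆ ∪ members xs) + card (⁅ x ⁆ ∩ members xs)  ≡⟨ card-∪-∩ ⁅ x ⁆ (members xs) ⟩
      card ⁅ x ⁆ + card (members xs)                         ≡⟨ cong₂ _+_ (card-⁅⁆ x) (card-members xs unique) ⟩
      suc (length xs)                                       ∎
      where
      open ≡-Reasoning
      disjoint : ∀ y → (⁅ x ⁆ ∩ members xs) y ≡ false
      disjoint y with x Finₚ.≟ y
      ... | yes refl = members-∉ xs x∉xs
      ... | no  _    = refl

open FiniteSubsets

module Sumsets where

  open import Data.Nat
  open import Data.Nat.Properties
  open import Data.Nat.DivMod using (m%n<n)
  open import Data.Nat.Primality using (Prime)
  open import Data.Nat.Induction using (<-wellFounded)
  open import Data.Bool using (Bool; true; false; _∧_; _∨_)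
  import Data.Bool as Bool
  open import Data.Fin using (Fin; toℕ)
  open import Data.Fin.Properties using (toℕ-fromℕ<; toℕ-injective; toℕ<n; any?)
  import Data.Fin.Properties as Finₚ
  open import Data.Nat.GeneralisedArithmetic using (iterate)
  open import Data.Product using (∃₂; _×_; _,_; proj₁; proj₂)
  open import Data.Sum using (_⊎_; inj₁; inj₂)
  open import Induction.WellFounded using (Acc; acc)
  open import Data.Empty using (⊥-elim)
  open import Function using (_∘_)
  open import Relation.Nullary using (¬_; yes; no; does; _×-dec_; ¬?)
  open import Relation.Nullary.Decidable using (dec-true)
  open import Relation.Binary.PropositionalEquality
  open import Defs using (modF)

  module Residues (n : ℕ) .{{_ : NonZero n}} where
    open Congruence n

    ⌊_⌋ : ℕ → Fin n
    ⌊_⌋ = modF n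

    0̂ : Fin n
    0̂ = ⌊ 0 ⌋

    toℕ-⌊⌋ : ∀ m → toℕ ⌊ m ⌋ ≈ m
    toℕ-⌊⌋ m = trans (cong (_% n) (toℕ-fromℕ< (m%n<n m n))) (%-≈ m)

    toℕ-≈-injective : ∀ {x y : Fin n} → toℕ x ≈ toℕ y → x ≡ y
    toℕ-≈-injective {x} {y} eq = toℕ-injective (≈⇒≡ (toℕ<n x) (toℕ<n y) eq)

    ⌊⌋-cong : ∀ {a b} → a ≈ b → ⌊ a ⌋ ≡ ⌊ b ⌋
    ⌊⌋-cong eq = toℕ-≈-injective (≈-trans (toℕ-⌊⌋ _) (≈-trans eq (≈-sym (toℕ-⌊⌋ _))))

    infixl 6 _⊕_ _⊖_
    _⊕_ : Fin n → Fin n → Fin n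
    x ⊕ y = ⌊ toℕ x + toℕ y ⌋

    _⊖_ : Fin n → Fin n → Fin n
    x ⊖ y = ⌊ toℕ x + neg (toℕ y) ⌋

    toℕ-⊕ : ∀ x y → toℕ (x ⊕ y) ≈ toℕ x + toℕ y
    toℕ-⊕ x y = toℕ-⌊⌋ _

    toℕ-⊖ : ∀ x y → toℕ (x ⊖ y) ≈ toℕ x + neg (toℕ y)
    toℕ-⊖ x y = toℕ-⌊⌋ _

    ⊕-comm : ∀ x y → x ⊕ y ≡ y ⊕ x
    ⊕-comm x y = cong ⌊_⌋ (+-comm (toℕ x) (toℕ y))

    ⊕-identityʳ : ∀ x → x ⊕ 0̂ ≡ x
    ⊕-identityʳ x = toℕ-≈-injective (begin
      toℕ (x ⊕ 0̂)     ≈⟨ toℕ-⊕ x 0̂ ⟩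
      toℕ x + toℕ 0̂   ≈⟨ +-cong (≈-refl {toℕ x}) (toℕ-⌊⌋ 0) ⟩
      toℕ x + 0       ≡⟨ +-identityʳ (toℕ x) ⟩
      toℕ x           ∎)
      where open ≈-Reasoning

    x⊖y⊕y≡x : ∀ x y → x ⊖ y ⊕ y ≡ x
    x⊖y⊕y≡x x y = toℕ-≈-injective (begin
      toℕ (x ⊖ y ⊕ y)                 ≈⟨ toℕ-⊕ (x ⊖ y) y ⟩
      toℕ (x ⊖ y) + toℕ y             ≈⟨ +-cong (toℕ-⊖ x y) ≈-refl ⟩
      toℕ x + neg (toℕ y) + toℕ y     ≡⟨ +-assoc (toℕ x) _ _ ⟩
      toℕ x + (neg (toℕ y) + toℕ y)   ≈⟨ +-cong (≈-refl {toℕ x}) (+-inverseˡ (toℕ y)) ⟩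
      toℕ x + 0                       ≡⟨ +-identityʳ (toℕ x) ⟩
      toℕ x                           ∎)
      where open ≈-Reasoning

    ⊖-unique : ∀ {x y z} → z ⊕ y ≡ x → x ⊖ y ≡ z
    ⊖-unique {x} {y} {z} refl = toℕ-≈-injective (begin
      toℕ (z ⊕ y ⊖ y)                 ≈⟨ toℕ-⊖ (z ⊕ y) y ⟩
      toℕ (z ⊕ y) + neg (toℕ y)       ≈⟨ +-cong (toℕ-⊕ z y) ≈-refl ⟩
      toℕ z + toℕ y + neg (toℕ y)     ≡⟨ +-assoc (toℕ z) _ _ ⟩
      toℕ z + (toℕ y + neg (toℕ y))   ≈⟨ +-cong (≈-refl {toℕ z}) (+-inverseʳ (toℕ y)) ⟩
      toℕ z + 0                       ≡⟨ +-identityʳ (toℕ z) ⟩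
      toℕ z                           ∎)
      where open ≈-Reasoning

    x⊕[y⊖x]≡y : ∀ x y → x ⊕ (y ⊖ x) ≡ y
    x⊕[y⊖x]≡y x y = trans (⊕-comm x (y ⊖ x)) (x⊖y⊕y≡x y x)

    x⊕y⊖y≡x : ∀ x y → x ⊕ y ⊖ y ≡ x
    x⊕y⊖y≡x x y = ⊖-unique refl

    x⊕y⊖x≡y : ∀ x y → x ⊕ y ⊖ x ≡ y
    x⊕y⊖x≡y x y = ⊖-unique (⊕-comm y x)

    x⊖[x⊖y]≡y : ∀ x y → x ⊖ (x ⊖ y) ≡ y
    x⊖[x⊖y]≡y x y = ⊖-unique (x⊕[y⊖x]≡y y x)

    ⊕-⊖-swap : ∀ x y z → x ⊕ (y ⊖ z) ≡ y ⊕ (x ⊖ z)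
    ⊕-⊖-swap x y z = toℕ-≈-injective (begin
      toℕ (x ⊕ (y ⊖ z))                ≈⟨ toℕ-⊕ x (y ⊖ z) ⟩
      toℕ x + toℕ (y ⊖ z)              ≈⟨ +-cong (≈-refl {toℕ x}) (toℕ-⊖ y z) ⟩
      toℕ x + (toℕ y + neg (toℕ z))    ≡⟨ +-assoc (toℕ x) (toℕ y) _ ⟨
      toℕ x + toℕ y + neg (toℕ z)      ≡⟨ cong (_+ neg (toℕ z)) (+-comm (toℕ x) (toℕ y)) ⟩
      toℕ y + toℕ x + neg (toℕ z)      ≡⟨ +-assoc (toℕ y) (toℕ x) _ ⟩
      toℕ y + (toℕ x + neg (toℕ z))    ≈⟨ +-cong (≈-refl {toℕ y}) (toℕ-⊖ x z) ⟨
      toℕ y + toℕ (x ⊖ z)              ≈⟨ toℕ-⊕ y (x ⊖ z) ⟨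
      toℕ (y ⊕ (x ⊖ z))                ∎)
      where open ≈-Reasoning

    card-translate : (A : FSet n) (c : Fin n) → card (λ y → A (y ⊖ c)) ≡ card A
    card-translate A c = card-permute A (_⊖ c) (_⊕ c) (λ y → x⊕y⊖y≡x y c) (λ y → x⊖y⊕y≡x y c)

    card-reflect : (A : FSet n) (c : Fin n) → card (λ y → A (c ⊖ y)) ≡ card A
    card-reflect A c = card-permute A (c ⊖_) (c ⊖_) (x⊖[x⊖y]≡y c) (x⊖[x⊖y]≡y c)

    infixl 6 _+ˢ_
    _+ˢ_ : FSet n → FSet n → FSet n
    (A +ˢ B) z = does (any? λ x → (A x Bool.≟ true) ×-dec (B (z ⊖ x) Bool.≟ true))

    +ˢ-intro : (A B : FSet n) {x y : Fin n} → A x ≡ true → B y ≡ true → (A +ˢ B) (x ⊕ y) ≡ true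
    +ˢ-intro A B {x} {y} Ax By = dec-true (any? _) (x , Ax , trans (cong B (x⊕y⊖x≡y x y)) By)

    +ˢ-elim : (A B : FSet n) {z : Fin n} → (A +ˢ B) z ≡ true →
              ∃₂ λ x y → A x ≡ true × B y ≡ true × x ⊕ y ≡ z
    +ˢ-elim A B {z} z∈A+B with any? (λ x → (A x Bool.≟ true) ×-dec (B (z ⊖ x) Bool.≟ true))
    +ˢ-elim A B {z} refl | yes (x , Ax , B[z⊖x]) = x , z ⊖ x , Ax , B[z⊖x] , x⊕[y⊖x]≡y x z

  module CauchyDavenport (q : ℕ) .{{_ : NonZero q}} (q-prime : Prime q) where
    open Congruence q
    open PrimeModulus q q-prime
    open Residues q
    open import Data.Nat.Tactic.RingSolver using (solve-∀)
    open import Data.Bool.Properties using (∧-comm)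

    toℕ-iterate : ∀ d x k → toℕ (iterate (_⊕ d) x k) ≈ toℕ x + k * toℕ d
    toℕ-iterate d x zero    = ≈-reflexive (sym (+-identityʳ (toℕ x)))
    toℕ-iterate d x (suc k) = begin
      toℕ (iterate (_⊕ d) (x ⊕ d) k)  ≈⟨ toℕ-iterate d (x ⊕ d) k ⟩
      toℕ (x ⊕ d) + k * toℕ d         ≈⟨ +-cong (toℕ-⊕ x d) (≈-refl {k * toℕ d}) ⟩
      toℕ x + toℕ d + k * toℕ d       ≡⟨ +-assoc (toℕ x) (toℕ d) (k * toℕ d) ⟩
      toℕ x + suc k * toℕ d           ∎
      where open ≈-Reasoning

    -- Since d is invertible mod q, the orbit of x₀ under x ↦ x + d is all of ℤ/q.
    translation-closed⇒full : (A : FSet q) (d : Fin q) → d ≢ 0̂ →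
      (∀ x → A x ≡ true → A (x ⊕ d) ≡ true) → ∀ {x₀} → A x₀ ≡ true → ∀ z → A z ≡ true
    translation-closed⇒full A d d≢0̂ closed {x₀} Ax₀ z = subst (λ w → A w ≡ true) hits (orbit k Ax₀)
      where
      d≉0 : ¬ toℕ d ≈ 0
      d≉0 d≈0 = d≢0̂ (toℕ-≈-injective (≈-trans d≈0 (≈-sym (toℕ-⌊⌋ 0))))
      d⁻¹ = proj₁ (inverse (toℕ d) d≉0)
      gap = toℕ z + neg (toℕ x₀)
      k = gap * d⁻¹
      orbit : ∀ k {x} → A x ≡ true → A (iterate (_⊕ d) x k) ≡ true
      orbit zero    Ax = Ax
      orbit (suc k) Ax = orbit k (closed _ Ax)
      regroup : ∀ a b c → a + (b + c) * 1 ≡ a + c + b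
      regroup = solve-∀
      hits : iterate (_⊕ d) x₀ k ≡ z
      hits = toℕ-≈-injective (begin
        toℕ (iterate (_⊕ d) x₀ k)        ≈⟨ toℕ-iterate d x₀ k ⟩
        toℕ x₀ + gap * d⁻¹ * toℕ d       ≡⟨ cong (toℕ x₀ +_) (*-assoc gap d⁻¹ (toℕ d)) ⟩
        toℕ x₀ + gap * (d⁻¹ * toℕ d)     ≈⟨ +-cong (≈-refl {toℕ x₀}) (*-cong (≈-refl {gap}) d⁻¹d≈1) ⟩
        toℕ x₀ + gap * 1                 ≡⟨ regroup (toℕ x₀) (toℕ z) (neg (toℕ x₀)) ⟩
        toℕ x₀ + neg (toℕ x₀) + toℕ z    ≈⟨ +-cong (+-inverseʳ (toℕ x₀)) (≈-refl {toℕ z}) ⟩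
        toℕ z                            ∎)
        where
        open ≈-Reasoning
        d⁻¹d≈1 : d⁻¹ * toℕ d ≈ 1
        d⁻¹d≈1 = ≈-trans (≈-reflexive (*-comm d⁻¹ (toℕ d))) (proj₂ (inverse (toℕ d) d≉0))

    card≤card-+ˢ : (A B : FSet q) {b : Fin q} → B b ≡ true → card A ≤ card (A +ˢ B)
    card≤card-+ˢ A B {b} Bb = begin
      card A                    ≡⟨ card-translate A b ⟨
      card (λ y → A (y ⊖ b))    ≤⟨ card-mono _ _ shifted-into ⟩
      card (A +ˢ B)             ∎
      where
      open ≤-Reasoning
      shifted-into : (λ y → A (y ⊖ b)) ⊆ A +ˢ B
      shifted-into y A[y⊖b] = subst (λ t → (A +ˢ B) t ≡ true) (x⊖y⊕y≡x y b) (+ˢ-intro A B A[y⊖b] Bb)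

    -- Dyson's e-transform with e = x - b, for x ∈ A, b, b' ∈ B and b' + e ∉ A.
    module DysonTransform (A B : FSet q) {x b b' : Fin q} (Ax : A x ≡ true) (Bb : B b ≡ true)
                          (b'+e∉A : A (b' ⊕ (x ⊖ b)) ≡ false) where

      e : Fin q
      e = x ⊖ b

      A′ B′ : FSet q
      A′ y = A y ∨ B (y ⊖ e)
      B′ y = B y ∧ A (y ⊕ e)

      A⊆A′ : A ⊆ A′
      A⊆A′ y Ay rewrite Ay = refl

      B′⊆B : B′ ⊆ B
      B′⊆B y B′y with B y
      ... | true = refl

      b∈B′ : B′ b ≡ true
      b∈B′ rewrite Bb | x⊕[y⊖x]≡y b x = Ax

      b'∉B′ : B′ b' ≡ false
      b'∉B′ rewrite b'+e∉A with B b'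
      ... | true  = refl
      ... | false = refl

      card-A′+B′ : card A′ + card B′ ≡ card A + card B
      card-A′+B′ = begin
        card A′ + card B′                  ≡⟨ cong (card A′ +_) B′-shifted ⟩
        card (A ∪ B↑) + card (A ∩ B↑)      ≡⟨ card-∪-∩ A B↑ ⟩
        card A + card B↑                   ≡⟨ cong (card A +_) (card-translate B e) ⟩
        card A + card B                    ∎
        where
        open ≡-Reasoning
        B↑ : FSet q
        B↑ y = B (y ⊖ e)
        B′-shifted : card B′ ≡ card (A ∩ B↑)
        B′-shifted = trans (sym (card-translate B′ e)) (card-cong λ y →
          trans (cong (λ t → B (y ⊖ e) ∧ A t) (x⊖y⊕y≡x y e)) (∧-comm (B (y ⊖ e)) (A y)))

      A′+B′⊆A+B : A′ +ˢ B′ ⊆ A +ˢ B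
      A′+B′⊆A+B z z∈A′+B′ with +ˢ-elim A′ B′ z∈A′+B′
      ... | u , v , A′u , B′v , refl with A u in Au | B v in Bv | A (v ⊕ e) in Av+e
      ... | true  | true | _    = +ˢ-intro A B Au Bv
      ... | false | true | true = subst (λ t → (A +ˢ B) t ≡ true) swapped (+ˢ-intro A B Av+e A′u)
        where
        swapped : v ⊕ e ⊕ (u ⊖ e) ≡ u ⊕ v
        swapped = trans (⊕-⊖-swap (v ⊕ e) u e) (cong (u ⊕_) (x⊕y⊖y≡x v e))

    CauchyDavenportBound : FSet q → FSet q → Set
    CauchyDavenportBound A B = q ≤ card (A +ˢ B) ⊎ card A + card B ≤ suc (card (A +ˢ B))

    ⊖-≡-0̂ : ∀ {x y} → x ⊖ y ≡ 0̂ → x ≡ y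
    ⊖-≡-0̂ {x} {y} x⊖y≡0̂ = begin
      x           ≡⟨ x⊖y⊕y≡x x y ⟨
      x ⊖ y ⊕ y   ≡⟨ cong (_⊕ y) x⊖y≡0̂ ⟩
      0̂ ⊕ y       ≡⟨ ⊕-comm 0̂ y ⟩
      y ⊕ 0̂       ≡⟨ ⊕-identityʳ y ⟩
      y           ∎
      where open ≡-Reasoning

    -- Either B has a second element b₁, and then A is stable under translation by b₁ - b₀, hence
    -- full, or B = {b₀}.
    bound-without-escape : (A B : FSet q) {b₀ : Fin q} → 1 ≤ card A → B b₀ ≡ true →
      (∀ {x b b'} → A x ≡ true → B b ≡ true → B b' ≡ true → A (b' ⊕ (x ⊖ b)) ≡ true) →
      CauchyDavenportBound A B
    bound-without-escape A B {b₀} ∣A∣>0 Bb₀ stable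
      with any? (λ b₁ → (B b₁ Bool.≟ true) ×-dec ¬? (b₁ Finₚ.≟ b₀))
    ... | yes (b₁ , Bb₁ , b₁≢b₀) = inj₁ (≤-reflexive (sym (card-full (A +ˢ B) sumset-full)))
      where
      A-full : ∀ z → A z ≡ true
      A-full = translation-closed⇒full A (b₁ ⊖ b₀) (b₁≢b₀ ∘ ⊖-≡-0̂)
        (λ x Ax → subst (λ t → A t ≡ true) (⊕-⊖-swap b₁ x b₀) (stable Ax Bb₀ Bb₁))
        (proj₂ (card-pos⇒∃ A ∣A∣>0))
      sumset-full : ∀ z → (A +ˢ B) z ≡ true
      sumset-full z = subst (λ t → (A +ˢ B) t ≡ true) (x⊖y⊕y≡x z b₀) (+ˢ-intro A B (A-full (z ⊖ b₀)) Bb₀)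
    ... | no ∄b₁ = inj₂ (begin
      card A + card B         ≤⟨ +-monoʳ-≤ (card A) ∣B∣≤1 ⟩
      card A + 1              ≡⟨ +-comm (card A) 1 ⟩
      suc (card A)            ≤⟨ s≤s (card≤card-+ˢ A B Bb₀) ⟩
      suc (card (A +ˢ B))     ∎)
      where
      open ≤-Reasoning
      only-b₀ : ∀ {y} → B y ≡ true → y ≡ b₀
      only-b₀ {y} By with y Finₚ.≟ b₀
      ... | yes y≡b₀ = y≡b₀
      ... | no  y≢b₀ = ⊥-elim (∄b₁ (y , By , y≢b₀))
      ∣B∣≤1 : card B ≤ 1
      ∣B∣≤1 = subsingleton⇒card≤1 B λ _ _ By By' → trans (only-b₀ By) (sym (only-b₀ By'))

    cauchy-davenport : (A B : FSet q) → 1 ≤ card A → 1 ≤ card B → CauchyDavenportBound A B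
    cauchy-davenport A B = induct A B (<-wellFounded (card B))
      where
      induct : (A B : FSet q) → Acc _<_ (card B) → 1 ≤ card A → 1 ≤ card B → CauchyDavenportBound A B
      induct A B (acc smaller) ∣A∣>0 ∣B∣>0
        with any? (λ x → any? λ b → any? λ b' → (A x Bool.≟ true) ×-dec (B b Bool.≟ true)
                                                 ×-dec (B b' Bool.≟ true) ×-dec (A (b' ⊕ (x ⊖ b)) Bool.≟ false))
      ... | yes (x , b , b' , Ax , Bb , Bb' , b'+e∉A) =
        transport (induct A′ B′ (smaller ∣B′∣<∣B∣) ∣A′∣>0 ∣B′∣>0)
        where
        open DysonTransform A B Ax Bb b'+e∉A
        ∣B′∣<∣B∣ : card B′ < card B
        ∣B′∣<∣B∣ = card-mono-< B′ B B′⊆B b' Bb' b'∉B′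
        ∣A′∣>0 : 1 ≤ card A′
        ∣A′∣>0 = ≤-trans ∣A∣>0 (card-mono A A′ A⊆A′)
        ∣B′∣>0 : 1 ≤ card B′
        ∣B′∣>0 = ∈⇒card-pos B′ b b∈B′
        shrink : card (A′ +ˢ B′) ≤ card (A +ˢ B)
        shrink = card-mono _ _ A′+B′⊆A+B
        transport : CauchyDavenportBound A′ B′ → CauchyDavenportBound A B
        transport (inj₁ full)  = inj₁ (≤-trans full shrink)
        transport (inj₂ bound) = inj₂ (≤-trans (≤-reflexive (sym card-A′+B′)) (≤-trans bound (s≤s shrink)))
      ... | no no-escape = bound-without-escape A B ∣A∣>0 (proj₂ (card-pos⇒∃ B ∣B∣>0)) stable
        where
        stable : ∀ {x b b'} → A x ≡ true → B b ≡ true → B b' ≡ true → A (b' ⊕ (x ⊖ b)) ≡ true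
        stable {x} {b} {b'} Ax Bb Bb' with A (b' ⊕ (x ⊖ b)) in b'+e∈A
        ... | true  = refl
        ... | false = ⊥-elim (no-escape (x , b , b' , Ax , Bb , Bb' , b'+e∈A))

open Sumsets

module MetacyclicCoordinates where

  open import Data.Nat
  open import Data.Nat.Properties
  open import Data.Nat.ListAction using (sum)
  open import Data.Nat.ListAction.Properties using (sum-++; sum-↭)
  open import Data.Nat.Tactic.RingSolver using (solve-∀)
  open import Data.Fin using (toℕ)
  open import Data.Integer using (ℤ)
  open import Data.List using (List; []; _∷_; _++_; map)
  open import Data.List.Properties using (map-++)
  open import Data.List.Relation.Binary.Permutation.Propositional using (_↭_)
  import Data.List.Relation.Binary.Permutation.Propositional.Properties as ↭ₚ
  open import Data.Product using (_,_; proj₁; proj₂)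
  open import Function using (_∘_)
  open import Relation.Binary.PropositionalEquality
  open import Defs

  module Coordinates (q p : ℕ) .{{_ : NonZero q}} .{{_ : NonZero p}} (r : ℤ) where
    open Metacyclic q p r
    module ℤq = Residues q
    module ℤp = Residues p
    module Q = Congruence q
    module P = Congruence p
    open P using () renaming (_≈_ to _≈p_)

    α-coord τ-coord : G → ℕ
    α-coord = toℕ ∘ proj₁
    τ-coord = toℕ ∘ proj₂

    -- prod L = τ^(τ-exp L) α^(α-exp L), with the exponents not yet reduced mod p and q.
    τ-exp : List G → ℕ
    τ-exp = sum ∘ map τ-coord

    α-exp : List G → ℕ
    α-exp []      = 0
    α-exp (g ∷ L) = α-coord g * r̄ ^ τ-exp L + α-exp L

    τ-exp-++ : ∀ U V → τ-exp (U ++ V) ≡ τ-exp U + τ-exp V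
    τ-exp-++ U V = trans (cong sum (map-++ τ-coord U V)) (sum-++ (map τ-coord U) (map τ-coord V))

    τ-exp-↭ : ∀ {U V} → U ↭ V → τ-exp U ≡ τ-exp V
    τ-exp-↭ = sum-↭ ∘ ↭ₚ.map⁺ τ-coord

    α-exp-++ : ∀ U V → α-exp (U ++ V) ≡ α-exp U * r̄ ^ τ-exp V + α-exp V
    α-exp-++ []      V = refl
    α-exp-++ (g ∷ U) V
      rewrite τ-exp-++ U V | α-exp-++ U V | ^-distribˡ-+-* r̄ (τ-exp U) (τ-exp V) =
      distribute (α-coord g) (r̄ ^ τ-exp U) (r̄ ^ τ-exp V) (α-exp U) (α-exp V)
      where
      distribute : ∀ a x y u v → a * (x * y) + (u * y + v) ≡ (a * x + u) * y + v
      distribute = solve-∀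

    prod-≡ : Q._≈_ (r̄ ^ p) 1 → ∀ L → prod L ≡ (ℤq.⌊ α-exp L ⌋ , ℤp.⌊ τ-exp L ⌋)
    prod-≡ r̄^p≈1 []            = refl
    prod-≡ r̄^p≈1 ((a , b) ∷ L) rewrite prod-≡ r̄^p≈1 L = cong₂ _,_
      (ℤq.⌊⌋-cong (Q.+-cong (Q.*-cong (Q.≈-refl {toℕ a}) (^-congʳ (ℤp.toℕ-⌊⌋ (τ-exp L))))
                            (ℤq.toℕ-⌊⌋ (α-exp L))))
      (ℤp.⌊⌋-cong (P.+-cong (P.≈-refl {toℕ b}) (ℤp.toℕ-⌊⌋ (τ-exp L))))
      where open Period q p r̄ r̄^p≈1

    τ-coord-∙ : ∀ x y → τ-coord (x ∙ y) ≈p τ-coord x + τ-coord y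
    τ-coord-∙ (a , b) (c , d) = ℤp.toℕ-⌊⌋ _

    τ-coord-e : τ-coord e ≈p 0
    τ-coord-e = ℤp.toℕ-⌊⌋ 0

    τ-coord-inverse : ∀ {x y} → x ∙ y ≡ e → τ-coord x + τ-coord y ≈p 0
    τ-coord-inverse {x} {y} xy≡e = begin
      τ-coord x + τ-coord y   ≈⟨ τ-coord-∙ x y ⟨
      τ-coord (x ∙ y)         ≡⟨ cong τ-coord xy≡e ⟩
      τ-coord e               ≈⟨ τ-coord-e ⟩
      0                       ∎
      where open P.≈-Reasoning

    InDerived⇒τ≈0 : ∀ {g} → InDerived g → τ-coord g ≈p 0
    InDerived⇒τ≈0 d-one = τ-coord-e
    InDerived⇒τ≈0 (d-comm x y x' y' xx'≡e yy'≡e) = begin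
      τ-coord (x' ∙ y' ∙ x ∙ y)
        ≈⟨ τ-coord-∙ (x' ∙ y' ∙ x) y ⟩
      τ-coord (x' ∙ y' ∙ x) + τ-coord y
        ≈⟨ P.+-cong (τ-coord-∙ (x' ∙ y') x) (P.≈-refl {τ-coord y}) ⟩
      τ-coord (x' ∙ y') + τ-coord x + τ-coord y
        ≈⟨ P.+-cong (P.+-cong (τ-coord-∙ x' y') (P.≈-refl {τ-coord x})) (P.≈-refl {τ-coord y}) ⟩
      τ-coord x' + τ-coord y' + τ-coord x + τ-coord y
        ≡⟨ regroup (τ-coord x') (τ-coord y') (τ-coord x) (τ-coord y) ⟩
      (τ-coord x + τ-coord x') + (τ-coord y + τ-coord y')
        ≈⟨ P.+-cong (τ-coord-inverse {x} {x'} xx'≡e) (τ-coord-inverse {y} {y'} yy'≡e) ⟩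
      0
        ∎
      where
      open P.≈-Reasoning
      regroup : ∀ a b c d → a + b + c + d ≡ (c + a) + (d + b)
      regroup = solve-∀
    InDerived⇒τ≈0 (d-mul {g} {h} dg dh) =
      P.≈-trans (τ-coord-∙ g h) (P.+-cong (InDerived⇒τ≈0 dg) (InDerived⇒τ≈0 dh))
    InDerived⇒τ≈0 (d-inv {g} {g'} dg gg'≡e) = P.+-cancelˡ (τ-coord g) (begin
      τ-coord g + τ-coord g'   ≈⟨ τ-coord-inverse {g} {g'} gg'≡e ⟩
      0                        ≈⟨ InDerived⇒τ≈0 dg ⟨
      τ-coord g                ≡⟨ +-identityʳ (τ-coord g) ⟨
      τ-coord g + 0            ∎)
      where open P.≈-Reasoning

open MetacyclicCoordinates

module ListBlocks where

  open import Data.Nat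
  open import Data.Nat.Properties
  open import Data.Nat.ListAction using (sum)
  open import Data.Nat.Induction using (<-wellFounded)
  open import Data.List using (List; []; _∷_; _++_; length; map)
  open import Data.List.Properties using (length-++; length-map; map-∘; ++-assoc)
  open import Data.List.Relation.Binary.Permutation.Propositional
    using (_↭_; ↭-refl; ↭-trans; ↭-reflexive; module PermutationReasoning)
  import Data.List.Relation.Binary.Permutation.Propositional.Properties as ↭ₚ
  import Data.List.Relation.Unary.All as All
  import Data.List.Relation.Unary.All.Properties as Allₚ
  open import Data.List.Relation.Unary.Any using (satisfied)
  open import Data.List.Relation.Unary.AllPairs using (_∷_)
  open import Data.List.Relation.Unary.Unique.Propositional using (Unique)
  import Data.List.Relation.Unary.AllPairs as AllPairs
  import Data.List.Relation.Unary.AllPairs.Properties as AllPairsₚ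
  open import Data.Product using (∃; _,_)
  open import Data.Sum using (_⊎_; inj₁; inj₂)
  import Data.Sum as Sum
  open import Function using (_∘_)
  open import Induction.WellFounded using (Acc; acc)
  open import Relation.Nullary.Decidable using (toSum)
  open import Relation.Binary.PropositionalEquality

  module _ {A : Set} where
    open import Data.List.Relation.Binary.Sublist.Propositional as Sublist using ([]; _∷_; _∷ʳ_)
    open import Data.List.Relation.Binary.Permutation.Propositional using (refl; prep; swap)
    open import Data.List.Relation.Binary.Permutation.Propositional as ↭ using (_↭_)
    open import Data.Product using (Σ; _×_)

    ⊆-↭⇒↭-⊆ : ∀ {T X Y : List A} → T Sublist.⊆ X → X ↭ Y → Σ (List A) λ T′ → T ↭ T′ × T′ Sublist.⊆ Y
    ⊆-↭⇒↭-⊆ s refl = _ , refl , s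
    ⊆-↭⇒↭-⊆ (x ∷ʳ s) (prep x p) with ⊆-↭⇒↭-⊆ s p
    ... | T′ , π , s′ = T′ , π , x ∷ʳ s′
    ⊆-↭⇒↭-⊆ (refl ∷ s) (prep x p) with ⊆-↭⇒↭-⊆ s p
    ... | T′ , π , s′ = x ∷ T′ , prep x π , refl ∷ s′
    ⊆-↭⇒↭-⊆ (x ∷ʳ (y ∷ʳ s)) (swap x y p) with ⊆-↭⇒↭-⊆ s p
    ... | T′ , π , s′ = T′ , π , y ∷ʳ (x ∷ʳ s′)
    ⊆-↭⇒↭-⊆ (x ∷ʳ (refl ∷ s)) (swap x y p) with ⊆-↭⇒↭-⊆ s p
    ... | T′ , π , s′ = y ∷ T′ , prep y π , refl ∷ (x ∷ʳ s′)
    ⊆-↭⇒↭-⊆ (refl ∷ (y ∷ʳ s)) (swap x y p) with ⊆-↭⇒↭-⊆ s p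
    ... | T′ , π , s′ = x ∷ T′ , prep x π , y ∷ʳ (refl ∷ s′)
    ⊆-↭⇒↭-⊆ (refl ∷ (refl ∷ s)) (swap x y p) with ⊆-↭⇒↭-⊆ s p
    ... | T′ , π , s′ = y ∷ x ∷ T′ , swap x y π , refl ∷ (refl ∷ s′)
    ⊆-↭⇒↭-⊆ s (↭.trans p₁ p₂) with ⊆-↭⇒↭-⊆ s p₁
    ... | T₁ , π₁ , s₁ with ⊆-↭⇒↭-⊆ s₁ p₂
    ...   | T₂ , π₂ , s₂ = T₂ , ↭-trans π₁ π₂ , s₂

  module Splits {A : Set} where

    record Split (T : List A) : Set where
      constructor split
      field
        prefix suffix    : List A
        prefix++suffix   : prefix ++ suffix ≡ T
        suffix-nonempty  : 1 ≤ length suffix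
    open Split public

    extend : ∀ x {T} → Split T → Split (x ∷ T)
    extend x (split U V eq nonempty) = split (x ∷ U) V (cong (x ∷_) eq) nonempty

    splits : (T : List A) → List (Split T)
    splits []      = []
    splits (x ∷ T) = split [] (x ∷ T) refl (s≤s z≤n) ∷ map (extend x) (splits T)

    length-splits : ∀ T → length (splits T) ≡ length T
    length-splits []      = refl
    length-splits (x ∷ T) = cong suc (trans (length-map (extend x) (splits T)) (length-splits T))

    rotation : ∀ {T} → Split T → List A
    rotation s = suffix s ++ prefix s

    rotation-↭ : ∀ {T} (s : Split T) → rotation s ↭ T
    rotation-↭ s = ↭-trans (↭ₚ.++-comm (suffix s) (prefix s)) (↭-reflexive (prefix++suffix s))

  module PrefixSums {A : Set} (p : ℕ) .{{_ : NonZero p}} (w : A → ℕ) where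
    open Splits {A}
    open Congruence p

    weight : List A → ℕ
    weight = sum ∘ map w

    prefix-residue : ∀ {T} → Split T → ℕ
    prefix-residue s = weight (prefix s) % p

    prefix-residues : List A → List ℕ
    prefix-residues T = map prefix-residue (splits T)

    record ZeroSumSegment (S : List A) : Set where
      constructor zero-sum-segment
      field
        before segment after : List A
        decomposition        : S ≡ before ++ segment ++ after
        segment-nonempty     : 1 ≤ length segment
        after-nonempty       : 1 ≤ length after
        segment-zero-sum     : weight segment ≈ 0

    extend-segment : ∀ x {S} → ZeroSumSegment S → ZeroSumSegment (x ∷ S)
    extend-segment x (zero-sum-segment B W R refl W≢[] R≢[] W≈0) = zero-sum-segment (x ∷ B) W R refl W≢[] R≢[] W≈0

    shifted-residue : ∀ x {S} → Split S → ℕ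
    shifted-residue x s = prefix-residue (extend x s)

    unique-prefix-residues⊎zero-sum-segment : ∀ S → Unique (prefix-residues S) ⊎ ZeroSumSegment S
    unique-prefix-residues⊎zero-sum-segment []      = inj₁ AllPairs.[]
    unique-prefix-residues⊎zero-sum-segment (x ∷ S) with unique-prefix-residues⊎zero-sum-segment S
    ... | inj₂ z      = inj₂ (extend-segment x z)
    ... | inj₁ unique with All.decide (λ s → Sum.swap (toSum (shifted-residue x s ≟ 0 % p))) (splits S)
    ...   | inj₂ hit = inj₂ (segment-from (satisfied hit))
      where
      segment-from : ∃ (λ s → shifted-residue x s ≡ 0 % p) → ZeroSumSegment (x ∷ S)
      segment-from (split U V refl V≢[] , x+U≈0) = zero-sum-segment [] (x ∷ U) V refl (s≤s z≤n) V≢[] x+U≈0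
    ...   | inj₁ misses = inj₁ (subst Unique (cong (0 % p ∷_) (map-∘ (splits S)))
        (Allₚ.map⁺ (All.map ≢-sym misses) ∷
         AllPairsₚ.map⁺ {f = shifted-residue x}
           (AllPairs.map (λ {s} {t} → cancel {s} {t}) (AllPairsₚ.map⁻ {f = prefix-residue} unique))))
      where
      cancel : ∀ {s t} → prefix-residue {S} s ≢ prefix-residue t → shifted-residue x s ≢ shifted-residue x t
      cancel {s} {t} ne eq = ne (+-cancelˡ (w x) {weight (prefix s)} {weight (prefix t)} eq)

    record Block (S : List A) : Set where
      constructor mkBlock
      field
        rest block      : List A
        ↭-rest++block   : S ↭ rest ++ block
        block-nonempty  : 1 ≤ length block
        block-zero-sum  : weight block ≈ 0
        block-unique    : Unique (prefix-residues block)

    zero-sum-block : ∀ S → 1 ≤ length S → weight S ≈ 0 → Block S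
    zero-sum-block S = go S (<-wellFounded (length S))
      where
      go : ∀ S → Acc _<_ (length S) → 1 ≤ length S → weight S ≈ 0 → Block S
      go S (acc shorter) S≢[] S≈0 with unique-prefix-residues⊎zero-sum-segment S
      ... | inj₁ unique = mkBlock [] S ↭-refl S≢[] S≈0 unique
      ... | inj₂ (zero-sum-segment B W R refl W≢[] R≢[] W≈0) = embed (go W (shorter W-shorter) W≢[] W≈0)
        where
        W-shorter : length W < length (B ++ W ++ R)
        W-shorter = begin-strict
          length W                     <⟨ m<m+n (length W) R≢[] ⟩
          length W + length R          ≡⟨ length-++ W ⟨
          length (W ++ R)              ≤⟨ m≤n+m _ (length B) ⟩
          length B + length (W ++ R)   ≡⟨ length-++ B ⟨
          length (B ++ W ++ R)         ∎
          where open ≤-Reasoning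
        embed : Block W → Block (B ++ W ++ R)
        embed (mkBlock rest T W↭rest++T T≢[] T≈0 unique) = mkBlock (B ++ rest ++ R) T reorder T≢[] T≈0 unique
          where
          open PermutationReasoning
          reorder : B ++ W ++ R ↭ (B ++ rest ++ R) ++ T
          reorder = begin
            B ++ W ++ R              ↭⟨ ↭ₚ.++⁺ˡ B (↭ₚ.++⁺ʳ R W↭rest++T) ⟩
            B ++ (rest ++ T) ++ R    ≡⟨ cong (B ++_) (++-assoc rest T R) ⟩
            B ++ rest ++ T ++ R      ↭⟨ ↭ₚ.++⁺ˡ B (↭ₚ.++⁺ˡ rest (↭ₚ.++-comm T R)) ⟩
            B ++ rest ++ R ++ T      ≡⟨ cong (B ++_) (++-assoc rest R T) ⟨
            B ++ (rest ++ R) ++ T    ≡⟨ ++-assoc B (rest ++ R) T ⟨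
            (B ++ rest ++ R) ++ T    ∎

open ListBlocks

module ProductOneSubsequences where

  open import Data.Nat
  open import Data.Nat.Properties
  open import Data.Nat.Induction using (<-wellFounded)
  open import Data.Nat.Primality using (Prime)
  open import Data.Nat.Tactic.RingSolver using (solve-∀)
  open import Data.Integer using (ℤ; _%ℕ_)
  open import Data.Bool using (true)
  open import Data.Fin using (Fin; toℕ)
  open import Data.List using (List; []; _∷_; _++_; length; map)
  open import Data.List.Properties using (length-++; length-map)
  open import Data.List.Membership.Propositional using (_∈_)
  open import Data.List.Relation.Unary.Any using (here; there)
  open import Data.List.Relation.Unary.Any.Properties using (map⁻)
  import Data.List.Relation.Unary.Any as Any
  open import Data.List.Relation.Unary.All using (universal)
  import Data.List.Relation.Unary.All.Properties as Allₚ
  open import Data.List.Relation.Unary.AllPairs using (_∷_)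
  import Data.List.Relation.Unary.AllPairs as AllPairs
  import Data.List.Relation.Unary.AllPairs.Properties as AllPairsₚ
  open import Data.List.Relation.Unary.Unique.Propositional using (Unique)
  open import Data.List.Relation.Binary.Permutation.Propositional using (_↭_; ↭-refl; ↭-sym; ↭-trans)
  import Data.List.Relation.Binary.Permutation.Propositional.Properties as ↭ₚ
  open import Data.List.Relation.Binary.Sublist.Propositional as Sublist using (⊆-refl)
  import Data.List.Relation.Binary.Sublist.Propositional.Properties as Sublistₚ
  open import Data.Product using (∃; _,_)
  open import Data.Sum using (_⊎_; inj₁; inj₂)
  open import Data.Empty using (⊥-elim)
  open import Function using (_∘_)
  open import Induction.WellFounded using (Acc; acc)
  open import Relation.Nullary using (¬_; yes; no)
  open import Relation.Binary.PropositionalEquality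
  open import Defs

  module ZeroSumTheory (q p : ℕ) .{{_ : NonZero q}} .{{_ : NonZero p}} (q-prime : Prime q) (p-prime : Prime p) (r : ℤ)
                       (r̄^p≈1 : Congruence._≈_ q ((r %ℕ q) ^ p) 1) (r̄≉1 : ¬ Congruence._≈_ q (r %ℕ q) 1) where
    open Metacyclic q p r
    open Coordinates q p r
    open Residues q
    open CauchyDavenport q q-prime
    open PrimeModulus q q-prime
    open Period q p r̄ r̄^p≈1
    open PrimeOrder q p q-prime p-prime r̄ r̄^p≈1 r̄≉1 using (x^≉0; ^-injective)
    open Splits {G}
    open PrefixSums p τ-coord using (prefix-residue; prefix-residues; Block; zero-sum-block)
    open Q using (≈-refl; ≈-sym; ≈-trans; ≈-reflexive; _≈?_) renaming (_≈_ to _≈q_)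
    open P using () renaming (_≈_ to _≈p_)

    α-exp-rotation : ∀ {T} (s : Split T) → τ-exp T ≈p 0 → α-exp (rotation s) ≈q r̄ ^ τ-exp (prefix s) * α-exp T
    α-exp-rotation (split U V refl _) τ≈0 = begin
      α-exp (V ++ U)
        ≡⟨ α-exp-++ V U ⟩
      α-exp V * r̄ ^ τ-exp U + α-exp U
        ≡⟨ cong (α-exp V * r̄ ^ τ-exp U +_) (*-identityʳ (α-exp U)) ⟨
      α-exp V * r̄ ^ τ-exp U + α-exp U * 1
        ≈⟨ Q.+-cong (≈-refl {α-exp V * r̄ ^ τ-exp U}) (Q.*-cong (≈-refl {α-exp U}) full-turn) ⟨
      α-exp V * r̄ ^ τ-exp U + α-exp U * (r̄ ^ τ-exp U * r̄ ^ τ-exp V)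
        ≡⟨ distribute (α-exp U) (α-exp V) (r̄ ^ τ-exp U) (r̄ ^ τ-exp V) ⟩
      r̄ ^ τ-exp U * (α-exp U * r̄ ^ τ-exp V + α-exp V)
        ≡⟨ cong (r̄ ^ τ-exp U *_) (α-exp-++ U V) ⟨
      r̄ ^ τ-exp U * α-exp (U ++ V)
        ∎
      where
      open Q.≈-Reasoning
      full-turn : r̄ ^ τ-exp U * r̄ ^ τ-exp V ≈q 1
      full-turn = ≈-trans (≈-reflexive (sym (^-distribˡ-+-* r̄ (τ-exp U) (τ-exp V))))
                          (^-congʳ (subst (_≈p 0) (τ-exp-++ U V) τ≈0))
      distribute : ∀ u v x y → v * x + u * (x * y) ≡ x * (u * y + v)
      distribute = solve-∀

    rotation-value : ∀ {T} → Split T → Fin q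
    rotation-value s = ⌊ α-exp (rotation s) ⌋

    rotation-values : List G → List (Fin q)
    rotation-values T = map rotation-value (splits T)

    length-rotation-values : ∀ T → length (rotation-values T) ≡ length T
    length-rotation-values T = trans (length-map rotation-value (splits T)) (length-splits T)

    module _ {T : List G} (τ≈0 : τ-exp T ≈p 0) (α≉0 : ¬ α-exp T ≈q 0) where

      toℕ-rotation-value : (s : Split T) → toℕ (rotation-value s) ≈q r̄ ^ τ-exp (prefix s) * α-exp T
      toℕ-rotation-value s = ≈-trans (toℕ-⌊⌋ _) (α-exp-rotation s τ≈0)

      rotation-value≢0̂ : (s : Split T) → 0̂ ≢ rotation-value s
      rotation-value≢0̂ s 0̂≡v = *-nonZero (x^≉0 (τ-exp (prefix s))) α≉0 (begin
        r̄ ^ τ-exp (prefix s) * α-exp T  ≈⟨ toℕ-rotation-value s ⟨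
        toℕ (rotation-value s)          ≡⟨ cong toℕ 0̂≡v ⟨
        toℕ 0̂                           ≈⟨ toℕ-⌊⌋ 0 ⟩
        0                               ∎)
        where open Q.≈-Reasoning

      rotation-value-injective : (s t : Split T) → rotation-value s ≡ rotation-value t →
                                 prefix-residue s ≡ prefix-residue t
      rotation-value-injective s t eq = ^-injective _ _ (*-cancelˡ (α-exp T) α≉0 (begin
        α-exp T * r̄ ^ τ-exp (prefix s)  ≡⟨ *-comm (α-exp T) _ ⟩
        r̄ ^ τ-exp (prefix s) * α-exp T  ≈⟨ toℕ-rotation-value s ⟨
        toℕ (rotation-value s)          ≡⟨ cong toℕ eq ⟩
        toℕ (rotation-value t)          ≈⟨ toℕ-rotation-value t ⟩
        r̄ ^ τ-exp (prefix t) * α-exp T  ≡⟨ *-comm _ (α-exp T) ⟩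
        α-exp T * r̄ ^ τ-exp (prefix t)  ∎))
        where open Q.≈-Reasoning

      unique-rotation-values : Unique (prefix-residues T) → Unique (0̂ ∷ rotation-values T)
      unique-rotation-values unique =
        Allₚ.map⁺ (universal rotation-value≢0̂ (splits T)) ∷
        AllPairsₚ.map⁺ {f = rotation-value}
          (AllPairs.map (λ {s} {t} ne eq → ne (rotation-value-injective s t eq)) (AllPairsₚ.map⁻ {f = prefix-residue} unique))

    record Achieves (S : List G) (y : Fin q) : Set where
      constructor achieves
      field
        support          : List G
        support⊆S        : support Sublist.⊆ S
        ordering         : List G
        ordering↭support : ordering ↭ support
        α-exp≈y          : α-exp ordering ≈q toℕ y
        τ-exp≈0          : τ-exp ordering ≈p 0

    achieves-[] : Achieves [] 0̂
    achieves-[] = achieves [] ⊆-refl [] ↭-refl (≈-sym (toℕ-⌊⌋ 0)) refl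

    achieves-↭ : ∀ {X Y y} → X ↭ Y → Achieves X y → Achieves Y y
    achieves-↭ X↭Y (achieves T T⊆X L L↭T α≈y τ≈0) with ⊆-↭⇒↭-⊆ T⊆X X↭Y
    ... | T′ , T↭T′ , T′⊆Y = achieves T′ T′⊆Y L (↭-trans L↭T T↭T′) α≈y τ≈0

    achieves-++ʳ : ∀ {S y} T → Achieves S y → Achieves (S ++ T) y
    achieves-++ʳ T (achieves U U⊆S L L↭U α≈y τ≈0) = achieves U (Sublistₚ.++⁺ʳ T U⊆S) L L↭U α≈y τ≈0

    achieves-rotation : ∀ {S T u} → τ-exp T ≈p 0 → Achieves S u → (s : Split T) →
                        Achieves (S ++ T) (u ⊕ rotation-value s)
    achieves-rotation {T = T} {u} τT≈0 (achieves U U⊆S L L↭U α≈u τ≈0) s =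
      achieves (U ++ T) (Sublistₚ.++⁺ U⊆S ⊆-refl) (L ++ rotation s) (↭ₚ.++⁺ L↭U (rotation-↭ s)) α≈ τ≈
      where
      τR≈0 : τ-exp (rotation s) ≈p 0
      τR≈0 = subst (_≈p 0) (sym (τ-exp-↭ (rotation-↭ s))) τT≈0
      α≈ : α-exp (L ++ rotation s) ≈q toℕ (u ⊕ rotation-value s)
      α≈ = begin
        α-exp (L ++ rotation s)
          ≡⟨ α-exp-++ L (rotation s) ⟩
        α-exp L * r̄ ^ τ-exp (rotation s) + α-exp (rotation s)
          ≈⟨ Q.+-cong (Q.*-cong α≈u (^-congʳ τR≈0)) (≈-sym (toℕ-⌊⌋ _)) ⟩
        toℕ u * r̄ ^ 0 + toℕ (rotation-value s)
          ≡⟨ cong (_+ toℕ (rotation-value s)) (*-identityʳ (toℕ u)) ⟩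
        toℕ u + toℕ (rotation-value s)
          ≈⟨ toℕ-⊕ u (rotation-value s) ⟨
        toℕ (u ⊕ rotation-value s)
          ∎
        where open Q.≈-Reasoning
      τ≈ : τ-exp (L ++ rotation s) ≈p 0
      τ≈ = P.≈-trans (P.≈-reflexive (τ-exp-++ L (rotation s))) (P.+-cong τ≈0 τR≈0)

    achieves-0̂⇒∈Π : ∀ {S y} (a : Achieves S y) → y ≡ 0̂ → 1 ≤ length (Achieves.support a) → e ∈Π S
    achieves-0̂⇒∈Π (achieves (t ∷ T) T⊆S L L↭T α≈y τ≈0) refl _ =
      t ∷ T , T⊆S , (t , T , refl) , L , L↭T ,
      trans (prod-≡ r̄^p≈1 L) (cong₂ _,_ (⌊⌋-cong (≈-trans α≈y (toℕ-⌊⌋ 0))) (ℤp.⌊⌋-cong τ≈0))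

    ∈Π-↭ : ∀ {X Y g} → X ↭ Y → g ∈Π X → g ∈Π Y
    ∈Π-↭ X↭Y (T , T⊆X , (t , T′ , refl) , L , L↭T , prod≡g) with ⊆-↭⇒↭-⊆ T⊆X X↭Y
    ... | []     , T↭[] , _    with () ← ↭ₚ.↭-empty-inv T↭[]
    ... | u ∷ U  , T↭U  , U⊆Y = u ∷ U , U⊆Y , (u , U , refl) , L , ↭-trans L↭T T↭U , prod≡g

    ∈Π-++ʳ : ∀ {S g} T → g ∈Π S → g ∈Π (S ++ T)
    ∈Π-++ʳ T (U , U⊆S , nonempty , g∈πU) = U , Sublistₚ.++⁺ʳ T U⊆S , nonempty , g∈πU

    record AchievedSet (S : List G) : Set where
      constructor mkAchievedSet
      field
        values   : FSet q
        achieved : ∀ y → values y ≡ true → Achieves S y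
        large    : length S < card values

    Progress : List G → Set
    Progress S = e ∈Π S ⊎ AchievedSet S

    progress-[] : Progress []
    progress-[] = inj₂ (mkAchievedSet ⁅ 0̂ ⁆
      (λ y 0̂≡y → subst (Achieves []) (⁅⁆-elim {x = 0̂} 0̂≡y) achieves-[])
      (≤-reflexive (sym (card-⁅⁆ 0̂))))

    progress-↭ : ∀ {X Y} → X ↭ Y → Progress X → Progress Y
    progress-↭ X↭Y (inj₁ e∈ΠX) = inj₁ (∈Π-↭ X↭Y e∈ΠX)
    progress-↭ X↭Y (inj₂ (mkAchievedSet Y achieved large)) = inj₂ (mkAchievedSet Y
      (λ y y∈Y → achieves-↭ X↭Y (achieved y y∈Y))
      (subst (_< card Y) (↭ₚ.↭-length X↭Y) large))

    module _ {S T : List G} (τT≈0 : τ-exp T ≈p 0) (T-nonempty : 1 ≤ length T) where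

      rotation-completes : ∀ {u} → Achieves S u → (s : Split T) → u ⊕ rotation-value s ≡ 0̂ → e ∈Π (S ++ T)
      rotation-completes a s u+v≡0̂ = achieves-0̂⇒∈Π (achieves-rotation τT≈0 a s) u+v≡0̂
        (≤-trans T-nonempty (≤-trans (m≤n+m (length T) _) (≤-reflexive (sym (length-++ (Achieves.support a))))))

      from-rotation-value : ∀ {v} → v ∈ rotation-values T → ∃ λ s → v ≡ rotation-value s
      from-rotation-value v∈ = Any.satisfied (map⁻ v∈)

      sumset-achieved : (Y : FSet q) → (∀ y → Y y ≡ true → Achieves S y) →
                        ∀ z → (Y +ˢ members (0̂ ∷ rotation-values T)) z ≡ true → Achieves (S ++ T) z
      sumset-achieved Y Y-achieved z z∈ with +ˢ-elim Y (members (0̂ ∷ rotation-values T)) z∈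
      ... | u , v , Yu , v∈ , refl with members-elim (0̂ ∷ rotation-values T) v∈
      ...   | here refl = subst (Achieves (S ++ T)) (sym (⊕-identityʳ u)) (achieves-++ʳ T (Y-achieved u Yu))
      ...   | there v∈′ with from-rotation-value v∈′
      ...     | s , refl = achieves-rotation τT≈0 (Y-achieved u Yu) s

      -- Y meets the reflection of the rotation values, so some u ∈ Y is completed to 0 by a rotation.
      reaches-zero : Unique (rotation-values T) → (Y : FSet q) → (∀ y → Y y ≡ true → Achieves S y) →
                     q < card Y + length T → e ∈Π (S ++ T)
      reaches-zero unique Y Y-achieved q<∣Y∣+∣T∣ = complete (card-pos⇒∃ (Y ∩ −O) (card-∩-pos Y −O bound))
        where
        O −O : FSet q
        O = members (rotation-values T)
        −O y = O (0̂ ⊖ y)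
        bound : q < card Y + card −O
        bound = subst (λ k → q < card Y + k) (sym ∣−O∣) q<∣Y∣+∣T∣
          where
          ∣−O∣ : card −O ≡ length T
          ∣−O∣ = trans (card-reflect O 0̂) (trans (card-members _ unique) (length-rotation-values T))
        complete : ∃ (λ u → (Y ∩ −O) u ≡ true) → e ∈Π (S ++ T)
        complete (u , u∈) with Y u in Yu | O (0̂ ⊖ u) in −u∈O
        ... | true | true with from-rotation-value (members-elim (rotation-values T) −u∈O)
        ...   | s , −u≡v = rotation-completes (Y-achieved u Yu) s
                             (trans (cong (u ⊕_) (sym −u≡v)) (x⊕[y⊖x]≡y u 0̂))

      extend-achieved-set : Unique (prefix-residues T) → ¬ α-exp T ≈q 0 → AchievedSet S → Progress (S ++ T)
      extend-achieved-set T-unique αT≉0 (mkAchievedSet Y achieved large) = conclude (cauchy-davenport Y O₀ ∣Y∣>0 ∣O₀∣>0)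
        where
        unique = unique-rotation-values τT≈0 αT≉0 T-unique
        O₀ = members (0̂ ∷ rotation-values T)
        ∣O₀∣ : card O₀ ≡ suc (length T)
        ∣O₀∣ = trans (card-members _ unique) (cong suc (length-rotation-values T))
        ∣Y∣>0 : 1 ≤ card Y
        ∣Y∣>0 = ≤-trans (s≤s z≤n) large
        ∣O₀∣>0 : 1 ≤ card O₀
        ∣O₀∣>0 = ≤-trans (s≤s z≤n) (≤-reflexive (sym ∣O₀∣))
        ∣S++T∣ : length (S ++ T) ≡ length S + length T
        ∣S++T∣ = length-++ S
        sumset : length (S ++ T) < card (Y +ˢ O₀) → Progress (S ++ T)
        sumset = inj₂ ∘ mkAchievedSet (Y +ˢ O₀) (sumset-achieved Y achieved)
        conclude : CauchyDavenportBound Y O₀ → Progress (S ++ T)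
        conclude (inj₁ q≤∣Y+O₀∣) with length (S ++ T) <? q
        ... | yes l<q = sumset (<-≤-trans l<q q≤∣Y+O₀∣)
        ... | no  l≮q = inj₁ (reaches-zero (AllPairs.tail unique) Y achieved (begin-strict
          q                       ≤⟨ ≮⇒≥ l≮q ⟩
          length (S ++ T)         ≡⟨ ∣S++T∣ ⟩
          length S + length T     <⟨ +-monoˡ-< (length T) large ⟩
          card Y + length T       ∎))
          where open ≤-Reasoning
        conclude (inj₂ ∣Y∣+∣O₀∣≤) = sumset (≤-pred (begin
          suc (suc (length (S ++ T)))       ≡⟨ cong (suc ∘ suc) ∣S++T∣ ⟩
          suc (suc (length S + length T))   ≡⟨ cong suc (+-suc (length S) (length T)) ⟨
          suc (length S) + suc (length T)   ≤⟨ +-mono-≤ large (≤-reflexive (sym ∣O₀∣)) ⟩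
          card Y + card O₀                  ≤⟨ ∣Y∣+∣O₀∣≤ ⟩
          suc (card (Y +ˢ O₀))              ∎))
          where open ≤-Reasoning

      extend-progress : Unique (prefix-residues T) → Progress S → Progress (S ++ T)
      extend-progress _ (inj₁ e∈ΠS) = inj₁ (∈Π-++ʳ T e∈ΠS)
      extend-progress T-unique (inj₂ A) with α-exp T ≈? 0
      ... | yes αT≈0 = inj₁ (achieves-0̂⇒∈Π T-itself refl T-nonempty)
        where
        T-itself : Achieves (S ++ T) 0̂
        T-itself = achieves T (Sublistₚ.++⁺ˡ S ⊆-refl) T ↭-refl (≈-trans αT≈0 (≈-sym (toℕ-⌊⌋ 0))) τT≈0
      ... | no  αT≉0 = extend-achieved-set T-unique αT≉0 A

    progress : ∀ S → τ-exp S ≈p 0 → Progress S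
    progress S = go S (<-wellFounded (length S))
      where
      go : ∀ S → Acc _<_ (length S) → τ-exp S ≈p 0 → Progress S
      go []      _             _   = progress-[]
      go (x ∷ S) (acc shorter) τ≈0 = progress-↭ (↭-sym ↭-rest++block)
        (extend-progress block-zero-sum block-nonempty block-unique (go rest (shorter rest-shorter) τ-rest≈0))
        where
        open Block (zero-sum-block (x ∷ S) (s≤s z≤n) τ≈0)
        ∣x∷S∣ : length (x ∷ S) ≡ length rest + length block
        ∣x∷S∣ = trans (↭ₚ.↭-length ↭-rest++block) (length-++ rest)
        rest-shorter : length rest < length (x ∷ S)
        rest-shorter = subst (length rest <_) (sym ∣x∷S∣) (m<m+n (length rest) block-nonempty)
        τ-rest≈0 : τ-exp rest ≈p 0
        τ-rest≈0 = P.+-cancelʳ (τ-exp block) (begin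
          τ-exp rest + τ-exp block   ≡⟨ τ-exp-++ rest block ⟨
          τ-exp (rest ++ block)      ≡⟨ τ-exp-↭ ↭-rest++block ⟨
          τ-exp (x ∷ S)              ≈⟨ τ≈0 ⟩
          0                          ≈⟨ block-zero-sum ⟨
          τ-exp block                ∎)
          where open P.≈-Reasoning

    derived⇒τ-exp≈0 : ∀ S → (∀ g → g ∈π S → InDerived g) → τ-exp S ≈p 0
    derived⇒τ-exp≈0 S derived = begin
      τ-exp S                  ≈⟨ ℤp.toℕ-⌊⌋ (τ-exp S) ⟨
      toℕ (ℤp.⌊ τ-exp S ⌋)     ≡⟨ cong τ-coord (prod-≡ r̄^p≈1 S) ⟨
      τ-coord (prod S)         ≈⟨ InDerived⇒τ≈0 (derived (prod S) (S , ↭-refl , refl)) ⟩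
      0                        ∎
      where open P.≈-Reasoning

    product-one-subsequence : ∀ S → τ-exp S ≈p 0 → q ≤ length S → e ∈Π S
    product-one-subsequence S τ≈0 q≤∣S∣ with progress S τ≈0
    ... | inj₁ e∈ΠS = e∈ΠS
    ... | inj₂ (mkAchievedSet Y _ large) = ⊥-elim (<⇒≱ (<-≤-trans large (card≤n Y)) q≤∣S∣)

open ProductOneSubsequences

open import Defs
open import Data.Nat using (ℕ; NonZero; _∸_; _≥_)
open import Data.Nat.Primality using (Prime)
open import Data.Nat.Divisibility using (_∣_)
open import Data.Integer using (ℤ; +_; _-_)
open import Data.Integer.Divisibility as ℤD using ()
open import Data.List using (List; length)
open import Relation.Nullary using (¬_)

lemma5p6 : (q p : ℕ) .{{_ : NonZero q}} .{{_ : NonZero p}} →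
    Prime p → Prime q → p ∣ q ∸ 1 →
    (r : ℤ) → (+ q) ℤD.∣ (r Data.Integer.^ p - + 1) → ¬ ((+ q) ℤD.∣ (r - + 1)) →
    let open Metacyclic q p r in
    (S : List G) → (∀ g → g ∈π S → InDerived g) → length S ≥ q →
    e ∈Π S
lemma5p6 q p p-prime q-prime _ r q∣r^p-1 q∤r-1 S derived q≤∣S∣ =
  product-one-subsequence S (derived⇒τ-exp≈0 S derived) q≤∣S∣
  where
  open IntegerResidue q
  open ZeroSumTheory q p q-prime p-prime r (r^k≡1⇒r̄^k≈1 r p q∣r^p-1) (r≢1⇒r̄≉1 r q∤r-1)
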